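{- Let $\ell \geq 7$ be an odd integer. Then the cycle $C_{2\ell}$ has a $3$-partite representation $\mathcal{H}_\ell$ such that $\mathcal{H}_\ell$ is a subgraph of a two-lift of the graph consisting of a cycle of length $\ell-3$ together with a pendant edge (an additional edge joining one vertex of the cycle to a new vertex).
   Context: The hypercube $Q_n$ has vertex set $\{A : A\subseteq [n]\}$ and edges $\{A,B\}$ with $A\subseteq B$, $|A|=|B|-1$; its $k$th layer is $\binom{[n]}{k}$, the set of $k$-element subsets of $[n]$. An $r$-graph on a vertex set $V$ is a pair $(V,E)$ with $E \subseteq \binom{V}{r}$. An $r$-graph is $k$-partite if its vertex set can be partitioned into $k$ parts so that every edge contains at most one vertex from each part. A graph $H$ has a $k$-partite representation $\mathcal{H}$ if, for some $n$, $H$ is isomorphic to a subgraph $H'$ of $Q_n$ whose vertex set is contained in $\binom{[n]}{k-1}\cup\binom{[n]}{k}$ and such that $V(H')\cap\binom{[n]}{k}$ is the edge set of a $k$-partite $k$-graph; this $k$-graph, taken without isolated vertices, is $\mathcal{H}$. For a $3$-graph and a vertex $x$, the link graph $L(x)$ is the graph without isolated vertices whose edges are the pairs $yz$ such that $xyz$ is an edge. For a bipartite graph $H$, a two-lift of $H$ is the $3$-graph with vertex set $\{a,b\}\cup V(H)$, where $a\neq b$ and $a,b\notin V(H)$, in which every edge contains exactly one of $a$, $b$, and $L(a)=L(b)=H$. -}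

module Defs where

open import Data.Nat using (ℕ; zero; suc; _+_; _*_; _∸_; _<_; _≤_)
open import Data.Fin using (Fin; toℕ)
open import Data.Fin.Subset using (Subset; _∈_; _⊆_; ∣_∣)
open import Data.Sum using (_⊎_; inj₁; inj₂)
open import Data.Product using (Σ; ∃; ∃-syntax; _×_; _,_)
open import Relation.Binary.PropositionalEquality using (_≡_; _≢_)

Odd : ℕ → Set
Odd ℓ = ∃[ k ] ℓ ≡ suc (2 * k)

-- Adjacency in the hypercube Q_n (A ⊂ B with |B| = |A| + 1, either direction)
QAdj : ∀ {n} → Subset n → Subset n → Set
QAdj A B = (A ⊆ B × ∣ B ∣ ≡ suc ∣ A ∣) ⊎ (B ⊆ A × ∣ A ∣ ≡ suc ∣ B ∣)

-- The cycle C_N has vertices 0,…,N-1 (as naturals) and edges {i,i+1} (i+1<N) and {N-1,0}.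
-- An embedding f of C_N as a subgraph of Q_n with vertices in layers 2 and 3.
IsCycleEmbedding23 : (N n : ℕ) → (ℕ → Subset n) → Set
IsCycleEmbedding23 N n f =
    (∀ i j → i < N → j < N → f i ≡ f j → i ≡ j)
  × (∀ i → i < N → ∣ f i ∣ ≡ 2 ⊎ ∣ f i ∣ ≡ 3)
  × (∀ i → suc i < N → QAdj (f i) (f (suc i)))
  × QAdj (f (N ∸ 1)) (f 0)

-- The 3-graph ℋ determined by f: edges are the 3-sets f i (i < N),
-- vertices are the elements of [n] lying in some edge (no isolated vertices).
IsEdgeℋ : (N n : ℕ) → (ℕ → Subset n) → Subset n → Set
IsEdgeℋ N n f e = ∃[ i ] (i < N × ∣ f i ∣ ≡ 3 × f i ≡ e)

IsVertexℋ : (N n : ℕ) → (ℕ → Subset n) → Fin n → Set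
IsVertexℋ N n f x = ∃[ e ] (IsEdgeℋ N n f e × x ∈ e)

Is3Partite : (N n : ℕ) → (ℕ → Subset n) → Set
Is3Partite N n f = Σ (Fin n → Fin 3) λ c →
  ∀ e → IsEdgeℋ N n f e → ∀ x y → x ∈ e → y ∈ e → x ≢ y → c x ≢ c y

Is3PartiteRep : (N n : ℕ) → (ℕ → Subset n) → Set
Is3PartiteRep N n f = IsCycleEmbedding23 N n f × Is3Partite N n f

-- The graph G_m: vertices 0,…,m; a cycle 0-1-…-(m-1)-0 of length m,
-- plus the pendant edge {0,m}.
GDir : ℕ → ℕ → ℕ → Set
GDir m i j = (suc i < m × j ≡ suc i) ⊎ (suc i ≡ m × j ≡ 0) ⊎ (i ≡ 0 × j ≡ m)

GAdj : (m : ℕ) → Fin (suc m) → Fin (suc m) → Set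
GAdj m u v = GDir m (toℕ u) (toℕ v) ⊎ GDir m (toℕ v) (toℕ u)

-- Two-lift of G_m: vertex set {a,b} ⊎ V(G_m) (a = inj₁ 0, b = inj₁ 1);
-- edges are {a,u,v} and {b,u,v} for uv ∈ E(G_m).
LiftVertex : ℕ → Set
LiftVertex m = Fin 2 ⊎ Fin (suc m)

LiftEdge₀ : (m : ℕ) → LiftVertex m → LiftVertex m → LiftVertex m → Set
LiftEdge₀ m p q r = ∃[ s ] ∃[ u ] ∃[ v ]
  (p ≡ inj₁ s × q ≡ inj₂ u × r ≡ inj₂ v × GAdj m u v)

-- {p,q,r} is an edge of the two-lift (in any order; GAdj is symmetric)
LiftEdge : (m : ℕ) → LiftVertex m → LiftVertex m → LiftVertex m → Set
LiftEdge m p q r = LiftEdge₀ m p q r ⊎ LiftEdge₀ m q r p ⊎ LiftEdge₀ m r p q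

SubgraphOfTwoLift : (N n : ℕ) → (ℕ → Subset n) → (m : ℕ) → Set
SubgraphOfTwoLift N n f m = Σ (Fin n → LiftVertex m) λ g →
    (∀ x y → IsVertexℋ N n f x → IsVertexℋ N n f y → g x ≡ g y → x ≡ y)
  × (∀ e → IsEdgeℋ N n f e → ∀ x y z → x ∈ e → y ∈ e → z ∈ e →
       x ≢ y → y ≢ z → x ≢ z → LiftEdge m (g x) (g y) (g z))

-- Write m = ℓ - 3 = q + 1, so that G_m is the cycle 0, 1, …, q with the pendant vertex m
-- attached to 0, and let a, b be the two apexes of its two-lift. Take as ℋ the ℓ edges
--   {k, k+1, a} (k < q),  {q, 0, a},  {0, m, a},  {0, m, b},  {0, 1, b}
-- in this cyclic order: consecutive edges meet in the pairs {k+1, a}, {0, a}, {0, m}, {0, b}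
-- and {0, 1}, so edges and meeting pairs alternate along a closed walk of length 2ℓ through
-- layers 3 and 2 of the cube on the vertex set of the two-lift. It is a cycle because all 2ℓ
-- sets are distinct, and every edge of ℋ is an apex together with an edge of G_m. Since ℓ is
-- odd, m is even, so G_m is properly 2-coloured by parity along the cycle with the pendant
-- vertex coloured 1; giving both apexes a third colour makes every edge of ℋ rainbow.

module Submission where

open import Data.Bool using (Bool; true; false)
open import Data.Empty using (⊥-elim)
open import Data.Fin as Fin using (Fin; zero; suc; toℕ)
open import Data.Fin.Properties as Finₚ using (toℕ-fromℕ<; +↔⊎)
open import Data.Fin.Subset using (Subset; _∈_; _⊆_; ∣_∣)
open import Data.List using (List; []; _∷_; length; map)
open import Data.List.Membership.Propositional using () renaming (_∈_ to _∈ₗ_; _∉_ to _∉ₗ_)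
open import Data.List.Membership.Propositional.Properties using (∈-map⁺)
open import Data.List.Relation.Binary.Subset.Propositional using () renaming (_⊆_ to _⊆ₗ_)
open import Data.List.Relation.Unary.All using ([]; _∷_) renaming (lookup to lookupᴬ)
open import Data.List.Relation.Unary.All.Properties using (All¬⇒¬Any)
open import Data.List.Relation.Unary.AllPairs using ([]; _∷_)
open import Data.List.Relation.Unary.Any using (here; there)
open import Data.List.Relation.Unary.Unique.Propositional using (Unique)
open import Data.List.Relation.Unary.Unique.Propositional.Properties using (Unique[x∷xs]⇒x∉xs)
open import Data.Nat using (ℕ; zero; suc; _+_; _*_; _∸_; _≤_; _<_; z≤n; s≤s; z<s; s<s⁻¹; ⌊_/2⌋; parity)
open import Data.Nat.DivMod using (_mod_; m<n⇒m%n≡m)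
open import Data.Nat.Properties
  using (_≟_; _<?_; ≤-refl; ≤-trans; <-trans; <⇒≤; <⇒≢; >⇒≢; ≤⇒≯; ≮⇒≥; n≤1+n; n<1+n; n≮n;
         m<n⇒m≤1+n; m<n⇒m<1+n; m≤n⇒m<n∨m≡n; m≤n+m; m+n≮n; +-mono-≤; +-suc; +-identityʳ;
         m+n∸n≡m; m∸n+n≡m; <-irrelevant; suc-injective)
open import Data.Parity.Base using (Parity; 0ℙ; 1ℙ)
open import Data.Parity.Properties using (suc-homo-⁻¹; *-homo-*; ⁻¹-selfInverse; p≢p⁻¹)
open import Data.Product using (Σ; ∃-syntax; _×_; _,_; proj₁; proj₂)
open import Data.Sum using (_⊎_; inj₁; inj₂; [_,_]′; swap)
open import Data.Sum.Properties using (inj₁-injective; inj₂-injective) renaming (≡-dec to ⊎-≡-dec)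
open import Data.Vec using (tabulate)
open import Data.Vec.Properties using (lookup∘tabulate; tabulate-cong; []=⇒lookup; lookup⇒[]=)
open import Function using (_∘_; _↔_; Inverse)
open import Relation.Binary.Definitions using (DecidableEquality)
open import Relation.Binary.PropositionalEquality
open import Relation.Nullary using (does; yes; no; contradiction; contraposition)
open import Relation.Nullary.Decidable using (dec-true; dec-false)

open import Defs

∣tabulate∣-insert : ∀ {n} (h h′ : Fin n → Bool) (p : Fin n) →
  h p ≡ false → h′ p ≡ true → (∀ x → x ≢ p → h′ x ≡ h x) →
  ∣ tabulate h′ ∣ ≡ suc ∣ tabulate h ∣
∣tabulate∣-insert h h′ zero hp≡false h′p≡true agree
  rewrite hp≡false | h′p≡true = cong (suc ∘ ∣_∣) (tabulate-cong λ x → agree (suc x) λ ())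
∣tabulate∣-insert h h′ (suc p) hp≡false h′p≡true agree
  with h′ zero | h zero | agree zero (λ ())
     | ∣tabulate∣-insert (h ∘ suc) (h′ ∘ suc) p hp≡false h′p≡true
         (λ x x≢p → agree (suc x) (x≢p ∘ Finₚ.suc-injective))
... | true  | .true  | refl | ih = cong suc ih
... | false | .false | refl | ih = ih

∣tabulate-false∣ : ∀ n → ∣ tabulate {n = n} (λ _ → false) ∣ ≡ 0
∣tabulate-false∣ zero    = refl
∣tabulate-false∣ (suc n) = ∣tabulate-false∣ n

Unique-map⇒injectiveOn : ∀ {A B : Set} {f : A → B} {xs x y} →
  Unique (map f xs) → x ∈ₗ xs → y ∈ₗ xs → f x ≡ f y → x ≡ y
Unique-map⇒injectiveOn _          (here refl) (here refl) _     = refl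
Unique-map⇒injectiveOn (fx∉ ∷ _)  (here refl) (there y∈)  fx≡fy =
  contradiction fx≡fy (lookupᴬ fx∉ (∈-map⁺ _ y∈))
Unique-map⇒injectiveOn (fy∉ ∷ _)  (there x∈)  (here refl) fx≡fy =
  contradiction (sym fx≡fy) (lookupᴬ fy∉ (∈-map⁺ _ x∈))
Unique-map⇒injectiveOn (_ ∷ fxs!) (there x∈)  (there y∈)  fx≡fy =
  Unique-map⇒injectiveOn fxs! x∈ y∈ fx≡fy

module Listed {n} {V : Set} (_≟_ : DecidableEquality V) (enum : Fin n ↔ V) where
  open Inverse enum public using (to)
  open Inverse enum using (from; strictlyInverseˡ; strictlyInverseʳ)
  open import Data.List.Membership.DecPropositional _≟_ using (_∈?_)

  to≡⇒≡from : ∀ {x v} → to x ≡ v → x ≡ from v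
  to≡⇒≡from {x} refl = sym (strictlyInverseʳ x)

  to-injective : ∀ {x y} → to x ≡ to y → x ≡ y
  to-injective {y = y} tx≡ty = trans (to≡⇒≡from tx≡ty) (strictlyInverseʳ y)

  ⟦_⟧ : List V → Subset n
  ⟦ L ⟧ = tabulate λ x → does (to x ∈? L)

  ∈⟦⟧⁺ : ∀ {L x} → to x ∈ₗ L → x ∈ ⟦ L ⟧
  ∈⟦⟧⁺ {L} {x} x∈L =
    lookup⇒[]= x _ (trans (lookup∘tabulate _ x) (dec-true (to x ∈? L) x∈L))

  ∈⟦⟧⁻ : ∀ {L x} → x ∈ ⟦ L ⟧ → to x ∈ₗ L
  ∈⟦⟧⁻ {L} {x} x∈⟦L⟧ with to x ∈? L | trans (sym (lookup∘tabulate _ x)) ([]=⇒lookup x∈⟦L⟧)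
  ... | yes to-x∈L | _ = to-x∈L
  ... | no _       | ()

  ⟦⟧-mono : ∀ {L L′} → L ⊆ₗ L′ → ⟦ L ⟧ ⊆ ⟦ L′ ⟧
  ⟦⟧-mono L⊆L′ = ∈⟦⟧⁺ ∘ L⊆L′ ∘ ∈⟦⟧⁻

  ⟦⟧-≡⇒⊆ : ∀ L L′ → ⟦ L ⟧ ≡ ⟦ L′ ⟧ → L ⊆ₗ L′
  ⟦⟧-≡⇒⊆ L L′ ⟦L⟧≡⟦L′⟧ {v} v∈L =
    subst (_∈ₗ L′) (strictlyInverseˡ v)
      (∈⟦⟧⁻ (subst (from v ∈_) ⟦L⟧≡⟦L′⟧ (∈⟦⟧⁺ (subst (_∈ₗ L) (sym (strictlyInverseˡ v)) v∈L))))

  ⟦⟧-apart : ∀ L L′ {v} → v ∈ₗ L → v ∉ₗ L′ → ⟦ L ⟧ ≢ ⟦ L′ ⟧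
  ⟦⟧-apart L L′ v∈L v∉L′ ⟦L⟧≡⟦L′⟧ = v∉L′ (⟦⟧-≡⇒⊆ L L′ ⟦L⟧≡⟦L′⟧ v∈L)

  ⟦⟧-apart′ : ∀ L L′ {v} → v ∈ₗ L′ → v ∉ₗ L → ⟦ L ⟧ ≢ ⟦ L′ ⟧
  ⟦⟧-apart′ L L′ v∈L′ v∉L = ⟦⟧-apart L′ L v∈L′ v∉L ∘ sym

  ∣⟦⟧∣ : ∀ {L} → Unique L → ∣ ⟦ L ⟧ ∣ ≡ length L
  ∣⟦⟧∣ {[]}    []                = ∣tabulate-false∣ n
  ∣⟦⟧∣ {v ∷ L} v∷L!@(_ ∷ L!) = trans
    (∣tabulate∣-insert _ _ (from v)
      (dec-false (to (from v) ∈? L)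
        (subst (_∉ₗ L) (sym (strictlyInverseˡ v)) (Unique[x∷xs]⇒x∉xs v∷L!)))
      (dec-true (to (from v) ∈? v ∷ L) (here (strictlyInverseˡ v)))
      unchanged)
    (cong suc (∣⟦⟧∣ L!))
    where
    unchanged : ∀ x → x ≢ from v → does (to x ∈? v ∷ L) ≡ does (to x ∈? L)
    unchanged x x≢ rewrite dec-false (to x ≟ v) (x≢ ∘ to≡⇒≡from) = refl

  QAdj-⟦⟧ : ∀ {L L′} → Unique L → Unique L′ → L ⊆ₗ L′ → length L′ ≡ suc (length L) →
            QAdj ⟦ L ⟧ ⟦ L′ ⟧
  QAdj-⟦⟧ {L} {L′} L! L′! L⊆L′ len = inj₁ (⟦⟧-mono L⊆L′ , (begin
    ∣ ⟦ L′ ⟧ ∣        ≡⟨ ∣⟦⟧∣ L′! ⟩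
    length L′         ≡⟨ len ⟩
    suc (length L)    ≡⟨ cong suc (∣⟦⟧∣ L!) ⟨
    suc ∣ ⟦ L ⟧ ∣     ∎))
    where open ≡-Reasoning

  rainbow-⟦⟧ : ∀ {C : Set} (c : V → C) L {x y} → Unique (map c L) →
               x ∈ ⟦ L ⟧ → y ∈ ⟦ L ⟧ → x ≢ y → c (to x) ≢ c (to y)
  rainbow-⟦⟧ _ _ cL! x∈ y∈ x≢y =
    x≢y ∘ to-injective ∘ Unique-map⇒injectiveOn cL! (∈⟦⟧⁻ x∈) (∈⟦⟧⁻ y∈)

doubleton-⊆ : ∀ {A : Set} {x y : A} {L} → x ∈ₗ L → y ∈ₗ L → x ∷ y ∷ [] ⊆ₗ L
doubleton-⊆ x∈L _   (here refl)         = x∈L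
doubleton-⊆ _   y∈L (there (here refl)) = y∈L

QAdj-sym : ∀ {n} {A B : Subset n} → QAdj A B → QAdj B A
QAdj-sym = swap

triangle : ∀ {m} → Fin 2 → Fin (suc m) → Fin (suc m) → List (LiftVertex m)
triangle s u v = inj₂ u ∷ inj₂ v ∷ inj₁ s ∷ []

GAdj-sym : ∀ {m u v} → GAdj m u v → GAdj m v u
GAdj-sym = swap

triangle-LiftEdge : ∀ {m s u v p p′ p″} → GAdj m u v →
  p ∈ₗ triangle s u v → p′ ∈ₗ triangle s u v → p″ ∈ₗ triangle s u v →
  p ≢ p′ → p′ ≢ p″ → p ≢ p″ → LiftEdge m p p′ p″
triangle-LiftEdge uv (here refl) (there (here refl)) (there (there (here refl))) _ _ _ =
  inj₂ (inj₂ (_ , _ , _ , refl , refl , refl , uv))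
triangle-LiftEdge uv (here refl) (there (there (here refl))) (there (here refl)) _ _ _ =
  inj₂ (inj₁ (_ , _ , _ , refl , refl , refl , GAdj-sym uv))
triangle-LiftEdge uv (there (here refl)) (here refl) (there (there (here refl))) _ _ _ =
  inj₂ (inj₂ (_ , _ , _ , refl , refl , refl , GAdj-sym uv))
triangle-LiftEdge uv (there (here refl)) (there (there (here refl))) (here refl) _ _ _ =
  inj₂ (inj₁ (_ , _ , _ , refl , refl , refl , uv))
triangle-LiftEdge uv (there (there (here refl))) (here refl) (there (here refl)) _ _ _ =
  inj₁ (_ , _ , _ , refl , refl , refl , uv)
triangle-LiftEdge uv (there (there (here refl))) (there (here refl)) (here refl) _ _ _ =
  inj₁ (_ , _ , _ , refl , refl , refl , GAdj-sym uv)
triangle-LiftEdge _ (here refl)                 (here refl)                 _ p≢p′ _ _ = contradiction refl p≢p′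
triangle-LiftEdge _ (there (here refl))         (there (here refl))         _ p≢p′ _ _ = contradiction refl p≢p′
triangle-LiftEdge _ (there (there (here refl))) (there (there (here refl))) _ p≢p′ _ _ = contradiction refl p≢p′
triangle-LiftEdge _ _ (here refl)                 (here refl)                 _ p′≢p″ _ = contradiction refl p′≢p″
triangle-LiftEdge _ _ (there (here refl))         (there (here refl))         _ p′≢p″ _ = contradiction refl p′≢p″
triangle-LiftEdge _ _ (there (there (here refl))) (there (there (here refl))) _ p′≢p″ _ = contradiction refl p′≢p″
triangle-LiftEdge _ (here refl)                 _ (here refl)                 _ _ p≢p″ = contradiction refl p≢p″
triangle-LiftEdge _ (there (here refl))         _ (there (here refl))         _ _ p≢p″ = contradiction refl p≢p″
triangle-LiftEdge _ (there (there (here refl))) _ (there (there (here refl))) _ _ p≢p″ = contradiction refl p≢p″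

side : ℕ → ℕ → Parity
side m u with u ≟ m
... | yes _ = 1ℙ
... | no  _ = parity u

side-pendant : ∀ m → side m m ≡ 1ℙ
side-pendant m with m ≟ m
... | yes _   = refl
... | no  m≢m = contradiction refl m≢m

side-cycle : ∀ {m u} → u ≢ m → side m u ≡ parity u
side-cycle {m} {u} u≢m with u ≟ m
... | yes u≡m = contradiction u≡m u≢m
... | no  _   = refl

parity-suc≢ : ∀ k → parity (suc k) ≢ parity k
parity-suc≢ k eq = p≢p⁻¹ _ (trans eq (sym (suc-homo-⁻¹ k)))

Odd⇒parity≡1ℙ : ∀ {q} → Odd q → parity q ≡ 1ℙ
Odd⇒parity≡1ℙ (k , refl) = sym (⁻¹-selfInverse (trans (suc-homo-⁻¹ (2 * k)) (*-homo-* 2 k)))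

GDir-side≢ : ∀ {q u v} → parity q ≡ 1ℙ → GDir (suc q) u v → side (suc q) u ≢ side (suc q) v
GDir-side≢ {q} {u} _ (inj₁ (1+u<m , refl))
  rewrite side-cycle (<⇒≢ (<-trans (n<1+n u) 1+u<m)) | side-cycle (<⇒≢ 1+u<m) =
  parity-suc≢ u ∘ sym
GDir-side≢ {q} q-odd (inj₂ (inj₁ (refl , refl)))
  rewrite side-cycle {suc q} (<⇒≢ (n<1+n q)) | side-cycle {suc q} {0} (λ ()) | q-odd = λ ()
GDir-side≢ {q} _ (inj₂ (inj₂ (refl , refl)))
  rewrite side-cycle {suc q} {0} (λ ()) | side-pendant (suc q) = λ ()

GAdj-side≢ : ∀ {q u v} → parity q ≡ 1ℙ → GAdj (suc q) u v →
             side (suc q) (toℕ u) ≢ side (suc q) (toℕ v)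
GAdj-side≢ q-odd = [ GDir-side≢ q-odd , (λ vu → GDir-side≢ q-odd vu ∘ sym) ]′

paint : Parity → Fin 3
paint 0ℙ = zero
paint 1ℙ = suc zero

paint-injective : ∀ {p p′} → paint p ≡ paint p′ → p ≡ p′
paint-injective {0ℙ} {0ℙ} _ = refl
paint-injective {1ℙ} {1ℙ} _ = refl

liftColour : ∀ m → LiftVertex m → Fin 3
liftColour m (inj₁ _) = suc (suc zero)
liftColour m (inj₂ u) = paint (side m (toℕ u))

triangle-rainbow : ∀ {m s u v} → side m (toℕ u) ≢ side m (toℕ v) →
                   Unique (map (liftColour m) (triangle s u v))
triangle-rainbow su≢sv =
  (su≢sv ∘ paint-injective ∷ paint≢2 _ ∷ []) ∷ (paint≢2 _ ∷ []) ∷ [] ∷ []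
  where
  paint≢2 : ∀ p → paint p ≢ suc (suc zero)
  paint≢2 0ℙ ()
  paint≢2 1ℙ ()

data Halving : ℕ → Set where
  even : ∀ k → Halving (k + k)
  odd  : ∀ k → Halving (suc (k + k))

halving : ∀ i → Halving i
halving zero = even zero
halving (suc i) with halving i
... | even k = odd k
... | odd  k = subst Halving (cong suc (+-suc k k)) (even (suc k))

parity-double : ∀ k → parity (k + k) ≡ 0ℙ
parity-double zero    = refl
parity-double (suc k) rewrite +-suc k k = parity-double k

parity-suc-double : ∀ k → parity (suc (k + k)) ≡ 1ℙ
parity-suc-double zero    = refl
parity-suc-double (suc k) rewrite +-suc k k = parity-suc-double k

⌊double/2⌋ : ∀ k → ⌊ k + k /2⌋ ≡ k
⌊double/2⌋ zero    = refl
⌊double/2⌋ (suc k) rewrite +-suc k k = cong suc (⌊double/2⌋ k)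

⌊suc-double/2⌋ : ∀ k → ⌊ suc (k + k) /2⌋ ≡ k
⌊suc-double/2⌋ zero    = refl
⌊suc-double/2⌋ (suc k) rewrite +-suc k k = cong suc (⌊suc-double/2⌋ k)

double-<⇒< : ∀ {k l} → k + k < l + l → k < l
double-<⇒< {k} {l} k+k<l+l with k <? l
... | yes k<l = k<l
... | no  k≮l = contradiction k+k<l+l (≤⇒≯ (+-mono-≤ (≮⇒≥ k≮l) (≮⇒≥ k≮l)))

module Construction (q : ℕ) (1<q : 1 < q) where

  m n N : ℕ
  m = suc q
  n = 2 + suc m
  N = 2 * (4 + q)

  -- The ground set Fin n is identified with the vertex set of the two-lift through splitAt 2
  -- (its elements 0 and 1 are the apexes a and b), and this identification embeds ℋ.
  open Listed (⊎-≡-dec Fin._≟_ Fin._≟_) (+↔⊎ {2} {suc m}) renaming (to to point)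

  -- Vertex u of G_m for u ≤ m; larger arguments wrap around and never occur.
  vertex : ℕ → Fin (suc m)
  vertex u = u mod suc m

  toℕ-vertex : ∀ {u} → u ≤ m → toℕ (vertex u) ≡ u
  toℕ-vertex u≤m = trans (toℕ-fromℕ< _) (m<n⇒m%n≡m (s≤s u≤m))

  node : ℕ → LiftVertex m
  node u = inj₂ (vertex u)

  node-injective : ∀ {u v} → u ≤ m → v ≤ m → node u ≡ node v → u ≡ v
  node-injective u≤m v≤m eq =
    trans (sym (toℕ-vertex u≤m)) (trans (cong toℕ (inj₂-injective eq)) (toℕ-vertex v≤m))

  node≢ : ∀ {u v} → u ≤ m → v ≤ m → u ≢ v → node u ≢ node v
  node≢ u≤m v≤m = contraposition (node-injective u≤m v≤m)

  a b : LiftVertex m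
  a = inj₁ zero
  b = inj₁ (suc zero)

  -- Rung r contributes the positions 2 · index r (its edge) and 2 · index r + 1 (its pair).
  data Rung : Set where
    ladder : (k : ℕ) → k < q → Rung
    wrap pendantᵃ pendantᵇ closing : Rung

  index : Rung → ℕ
  index (ladder k _) = k
  index wrap         = q
  index pendantᵃ     = 1 + q
  index pendantᵇ     = 2 + q
  index closing      = 3 + q

  apex : Rung → Fin 2
  apex (ladder _ _) = zero
  apex wrap         = zero
  apex pendantᵃ     = zero
  apex pendantᵇ     = suc zero
  apex closing      = suc zero

  end₁ end₂ : Rung → ℕ
  end₁ (ladder k _) = k
  end₁ wrap         = q
  end₁ pendantᵃ     = 0
  end₁ pendantᵇ     = 0
  end₁ closing      = 0
  end₂ (ladder k _) = suc k
  end₂ wrap         = 0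
  end₂ pendantᵃ     = m
  end₂ pendantᵇ     = m
  end₂ closing      = 1

  triple : Rung → List (LiftVertex m)
  triple r = triangle (apex r) (vertex (end₁ r)) (vertex (end₂ r))

  pair : Rung → List (LiftVertex m)
  pair (ladder k _) = node (suc k) ∷ a ∷ []
  pair wrap         = node 0 ∷ a ∷ []
  pair pendantᵃ     = node 0 ∷ node m ∷ []
  pair pendantᵇ     = node 0 ∷ b ∷ []
  pair closing      = node 0 ∷ node 1 ∷ []

  0<q : 0 < q
  0<q = <-trans z<s 1<q

  <q⇒≤m : ∀ {u} → u < q → u ≤ m
  <q⇒≤m = m<n⇒m≤1+n

  ends-≤ : ∀ r → end₁ r ≤ m × end₂ r ≤ m
  ends-≤ (ladder k k<q) = <q⇒≤m k<q , s≤s (<⇒≤ k<q)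
  ends-≤ wrap           = n≤1+n q , z≤n
  ends-≤ pendantᵃ       = z≤n , ≤-refl
  ends-≤ pendantᵇ       = z≤n , ≤-refl
  ends-≤ closing        = z≤n , s≤s z≤n

  ends-distinct : ∀ r → end₁ r ≢ end₂ r
  ends-distinct (ladder k _) = <⇒≢ (n<1+n k)
  ends-distinct wrap         = >⇒≢ 0<q
  ends-distinct pendantᵃ     = λ ()
  ends-distinct pendantᵇ     = λ ()
  ends-distinct closing      = λ ()

  rung-GDir : ∀ r → GDir m (end₁ r) (end₂ r)
  rung-GDir (ladder k k<q) = inj₁ (s≤s k<q , refl)
  rung-GDir wrap           = inj₂ (inj₁ (refl , refl))
  rung-GDir pendantᵃ       = inj₂ (inj₂ (refl , refl))
  rung-GDir pendantᵇ       = inj₂ (inj₂ (refl , refl))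
  rung-GDir closing        = inj₁ (s≤s 0<q , refl)

  rung-GAdj : ∀ r → GAdj m (vertex (end₁ r)) (vertex (end₂ r))
  rung-GAdj r = inj₁ (subst₂ (GDir m) (sym (toℕ-vertex e₁≤m)) (sym (toℕ-vertex e₂≤m)) (rung-GDir r))
    where e₁≤m = proj₁ (ends-≤ r); e₂≤m = proj₂ (ends-≤ r)

  triple-unique : ∀ r → Unique (triple r)
  triple-unique r =
    (node≢ (proj₁ (ends-≤ r)) (proj₂ (ends-≤ r)) (ends-distinct r) ∷ (λ ()) ∷ []) ∷ ((λ ()) ∷ []) ∷ [] ∷ []

  pair-unique : ∀ r → Unique (pair r)
  pair-unique (ladder _ _) = ((λ ()) ∷ []) ∷ [] ∷ []
  pair-unique wrap         = ((λ ()) ∷ []) ∷ [] ∷ []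
  pair-unique pendantᵃ     = (node≢ z≤n ≤-refl (λ ()) ∷ []) ∷ [] ∷ []
  pair-unique pendantᵇ     = ((λ ()) ∷ []) ∷ [] ∷ []
  pair-unique closing      = (node≢ z≤n (s≤s z≤n) (λ ()) ∷ []) ∷ [] ∷ []

  length-pair : ∀ r → length (pair r) ≡ 2
  length-pair (ladder _ _) = refl
  length-pair wrap         = refl
  length-pair pendantᵃ     = refl
  length-pair pendantᵇ     = refl
  length-pair closing      = refl

  pair⊆triple : ∀ r → pair r ⊆ₗ triple r
  pair⊆triple (ladder _ _) = doubleton-⊆ (there (here refl)) (there (there (here refl)))
  pair⊆triple wrap         = doubleton-⊆ (there (here refl)) (there (there (here refl)))
  pair⊆triple pendantᵃ     = doubleton-⊆ (here refl) (there (here refl))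
  pair⊆triple pendantᵇ     = doubleton-⊆ (here refl) (there (there (here refl)))
  pair⊆triple closing      = doubleton-⊆ (here refl) (there (here refl))

  above : ℕ → Rung
  above 0 = wrap
  above 1 = pendantᵃ
  above 2 = pendantᵇ
  above _ = closing

  rungAt : ℕ → Rung
  rungAt k with k <? q
  ... | yes k<q = ladder k k<q
  ... | no  _   = above (k ∸ q)

  rungAt-above : ∀ j → rungAt (j + q) ≡ above j
  rungAt-above j with j + q <? q
  ... | yes j+q<q = contradiction j+q<q (m+n≮n j q)
  ... | no  _     = cong above (m+n∸n≡m j q)

  rungAt-index : ∀ r → rungAt (index r) ≡ r
  rungAt-index (ladder k k<q) with k <? q
  ... | yes k<q′ = cong (ladder k) (<-irrelevant k<q′ k<q)
  ... | no  k≮q  = contradiction k<q k≮q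
  rungAt-index wrap     = rungAt-above 0
  rungAt-index pendantᵃ = rungAt-above 1
  rungAt-index pendantᵇ = rungAt-above 2
  rungAt-index closing  = rungAt-above 3

  index-above : ∀ j → j + q < 4 + q → index (above j) ≡ j + q
  index-above 0 _ = refl
  index-above 1 _ = refl
  index-above 2 _ = refl
  index-above 3 _ = refl
  index-above (suc (suc (suc (suc j)))) j+q<q =
    contradiction (s<s⁻¹ (s<s⁻¹ (s<s⁻¹ (s<s⁻¹ j+q<q)))) (m+n≮n j q)

  index-rungAt : ∀ k → k < 4 + q → index (rungAt k) ≡ k
  index-rungAt k k<4+q with k <? q
  ... | yes _   = refl
  ... | no  k≮q = trans (index-above (k ∸ q) (subst (_< 4 + q) (sym k∸q+q≡k) k<4+q)) k∸q+q≡k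
    where k∸q+q≡k = m∸n+n≡m (≮⇒≥ k≮q)

  pair⊆next-triple : ∀ r → index r < 3 + q → pair r ⊆ₗ triple (rungAt (suc (index r)))
  pair⊆next-triple (ladder k k<q) _ with m≤n⇒m<n∨m≡n k<q
  ... | inj₁ 1+k<q rewrite rungAt-index (ladder (suc k) 1+k<q) =
    doubleton-⊆ (here refl) (there (there (here refl)))
  ... | inj₂ refl  rewrite rungAt-index wrap =
    doubleton-⊆ (here refl) (there (there (here refl)))
  pair⊆next-triple wrap     _ rewrite rungAt-index pendantᵃ = doubleton-⊆ (here refl) (there (there (here refl)))
  pair⊆next-triple pendantᵃ _ rewrite rungAt-index pendantᵇ = doubleton-⊆ (here refl) (there (here refl))
  pair⊆next-triple pendantᵇ _ rewrite rungAt-index closing  = doubleton-⊆ (here refl) (there (there (here refl)))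
  pair⊆next-triple closing  3+q<3+q = contradiction 3+q<3+q (n≮n _)

  data Position : ℕ → Set where
    at-triple : ∀ r → Position (index r + index r)
    at-pair   : ∀ r → Position (suc (index r + index r))

  N≡double : N ≡ (4 + q) + (4 + q)
  N≡double = cong ((4 + q) +_) (+-identityʳ (4 + q))

  position : ∀ i → i < N → Position i
  position i i<N with halving i
  ... | even k = subst (Position ∘ λ j → j + j) (index-rungAt k k<4+q) (at-triple (rungAt k))
    where k<4+q = double-<⇒< (subst (k + k <_) N≡double i<N)
  ... | odd k = subst (Position ∘ λ j → suc (j + j)) (index-rungAt k k<4+q) (at-pair (rungAt k))
    where k<4+q = double-<⇒< (subst (k + k <_) N≡double (<-trans (n<1+n _) i<N))

  layer : Parity → Rung → List (LiftVertex m)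
  layer 0ℙ = triple
  layer 1ℙ = pair

  f : ℕ → Subset n
  f i = ⟦ layer (parity i) (rungAt ⌊ i /2⌋) ⟧

  f-double : ∀ k → f (k + k) ≡ ⟦ triple (rungAt k) ⟧
  f-double k rewrite parity-double k | ⌊double/2⌋ k = refl

  f-triple : ∀ r → f (index r + index r) ≡ ⟦ triple r ⟧
  f-triple r = trans (f-double (index r)) (cong (⟦_⟧ ∘ triple) (rungAt-index r))

  f-pair : ∀ r → f (suc (index r + index r)) ≡ ⟦ pair r ⟧
  f-pair r rewrite parity-suc-double (index r) | ⌊suc-double/2⌋ (index r) | rungAt-index r = refl

  f-next-triple : ∀ r → f (suc (suc (index r + index r))) ≡ ⟦ triple (rungAt (suc (index r))) ⟧
  f-next-triple r = trans (cong f (cong suc (sym (+-suc (index r) (index r))))) (f-double (suc (index r)))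

  ∣f-triple∣ : ∀ r → ∣ f (index r + index r) ∣ ≡ 3
  ∣f-triple∣ r = trans (cong ∣_∣ (f-triple r)) (∣⟦⟧∣ (triple-unique r))

  ∣f-pair∣ : ∀ r → ∣ f (suc (index r + index r)) ∣ ≡ 2
  ∣f-pair∣ r = trans (cong ∣_∣ (f-pair r)) (trans (∣⟦⟧∣ (pair-unique r)) (length-pair r))

  triple-apart-apex : ∀ r r′ → apex r ≢ apex r′ → ⟦ triple r ⟧ ≢ ⟦ triple r′ ⟧
  triple-apart-apex r r′ s≢s′ =
    ⟦⟧-apart (triple r) (triple r′) (there (there (here refl))) (All¬⇒¬Any ((λ ()) ∷ (λ ()) ∷ s≢s′ ∘ inj₁-injective ∷ []))

  pendant∉triple : ∀ r → end₁ r < m → end₂ r < m → node m ∉ₗ triple r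
  pendant∉triple r e₁<m e₂<m = All¬⇒¬Any
    (node≢ ≤-refl (<⇒≤ e₁<m) (>⇒≢ e₁<m) ∷ node≢ ≤-refl (<⇒≤ e₂<m) (>⇒≢ e₂<m) ∷ (λ ()) ∷ [])

  pendant∉ladder : ∀ {k} (k<q : k < q) → node m ∉ₗ triple (ladder k k<q)
  pendant∉ladder k<q = pendant∉triple (ladder _ k<q) (m<n⇒m<1+n k<q) (s≤s k<q)

  pendant∉wrap : node m ∉ₗ triple wrap
  pendant∉wrap = pendant∉triple wrap (n<1+n q) z<s

  pendant∉closing : node m ∉ₗ triple closing
  pendant∉closing = pendant∉triple closing z<s (s≤s 0<q)

  interior∉wrap : ∀ {u} → 0 < u → u < q → node u ∉ₗ triple wrap
  interior∉wrap 0<u u<q = All¬⇒¬Any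
    (node≢ (<q⇒≤m u<q) (n≤1+n q) (<⇒≢ u<q) ∷ node≢ (<q⇒≤m u<q) z≤n (>⇒≢ 0<u) ∷ (λ ()) ∷ [])

  -- {k, k+1, a} = {q, 0, a} would force k = 0 and k + 1 = q, but q ≠ 1.
  ladder≢wrap : ∀ {k} (k<q : k < q) → ⟦ triple (ladder k k<q) ⟧ ≢ ⟦ triple wrap ⟧
  ladder≢wrap {zero}  k<q = ⟦⟧-apart (triple (ladder _ k<q)) (triple wrap) (there (here refl)) (interior∉wrap z<s 1<q)
  ladder≢wrap {suc _} k<q = ⟦⟧-apart (triple (ladder _ k<q)) (triple wrap) (here refl) (interior∉wrap z<s k<q)

  ladder-injective : ∀ {k k′} (k<q : k < q) (k′<q : k′ < q) →
    ⟦ triple (ladder k k<q) ⟧ ≡ ⟦ triple (ladder k′ k′<q) ⟧ → k ≡ k′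
  ladder-injective {k} {k′} k<q k′<q eq
    with ⟦⟧-≡⇒⊆ (triple (ladder k k<q)) (triple (ladder k′ k′<q)) eq (here refl)
       | ⟦⟧-≡⇒⊆ (triple (ladder k′ k′<q)) (triple (ladder k k<q)) (sym eq) (here refl)
  ... | here k≈k′ | _ = node-injective (<q⇒≤m k<q) (<q⇒≤m k′<q) k≈k′
  ... | there (here _) | here k′≈k = sym (node-injective (<q⇒≤m k′<q) (<q⇒≤m k<q) k′≈k)
  ... | there (here k≈1+k′) | there (here k′≈1+k) =
    contradiction (trans (node-injective (<q⇒≤m k<q) (s≤s (<⇒≤ k′<q)) k≈1+k′)
                         (cong suc (node-injective (<q⇒≤m k′<q) (s≤s (<⇒≤ k<q)) k′≈1+k)))
                  (<⇒≢ (m<n⇒m<1+n (n<1+n k)))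
  ... | there (there (here ())) | _
  ... | _ | there (there (here ()))

  triple-injective : ∀ r r′ → ⟦ triple r ⟧ ≡ ⟦ triple r′ ⟧ → index r ≡ index r′
  triple-injective (ladder _ k<q) (ladder _ k′<q) = ladder-injective k<q k′<q
  triple-injective (ladder _ k<q) wrap         = ⊥-elim ∘ ladder≢wrap k<q
  triple-injective wrap         (ladder _ k<q) = ⊥-elim ∘ ladder≢wrap k<q ∘ sym
  triple-injective r@(ladder _ k<q) r′@pendantᵃ =
    ⊥-elim ∘ ⟦⟧-apart′ (triple r) (triple r′) (there (here refl)) (pendant∉ladder k<q)
  triple-injective r@pendantᵃ r′@(ladder _ k<q) =
    ⊥-elim ∘ ⟦⟧-apart (triple r) (triple r′) (there (here refl)) (pendant∉ladder k<q)
  triple-injective r@wrap     r′@pendantᵃ = ⊥-elim ∘ ⟦⟧-apart′ (triple r) (triple r′) (there (here refl)) pendant∉wrap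
  triple-injective r@pendantᵃ r′@wrap     = ⊥-elim ∘ ⟦⟧-apart (triple r) (triple r′) (there (here refl)) pendant∉wrap
  triple-injective r@pendantᵇ r′@closing  = ⊥-elim ∘ ⟦⟧-apart (triple r) (triple r′) (there (here refl)) pendant∉closing
  triple-injective r@closing  r′@pendantᵇ = ⊥-elim ∘ ⟦⟧-apart′ (triple r) (triple r′) (there (here refl)) pendant∉closing
  triple-injective r@(ladder _ _) r′@pendantᵇ   = ⊥-elim ∘ triple-apart-apex r r′ (λ ())
  triple-injective r@(ladder _ _) r′@closing    = ⊥-elim ∘ triple-apart-apex r r′ (λ ())
  triple-injective r@wrap         r′@pendantᵇ   = ⊥-elim ∘ triple-apart-apex r r′ (λ ())
  triple-injective r@wrap         r′@closing    = ⊥-elim ∘ triple-apart-apex r r′ (λ ())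
  triple-injective r@pendantᵃ     r′@pendantᵇ   = ⊥-elim ∘ triple-apart-apex r r′ (λ ())
  triple-injective r@pendantᵃ     r′@closing    = ⊥-elim ∘ triple-apart-apex r r′ (λ ())
  triple-injective r@pendantᵇ     r′@(ladder _ _) = ⊥-elim ∘ triple-apart-apex r r′ (λ ())
  triple-injective r@pendantᵇ     r′@wrap       = ⊥-elim ∘ triple-apart-apex r r′ (λ ())
  triple-injective r@pendantᵇ     r′@pendantᵃ   = ⊥-elim ∘ triple-apart-apex r r′ (λ ())
  triple-injective r@closing      r′@(ladder _ _) = ⊥-elim ∘ triple-apart-apex r r′ (λ ())
  triple-injective r@closing      r′@wrap       = ⊥-elim ∘ triple-apart-apex r r′ (λ ())
  triple-injective r@closing      r′@pendantᵃ   = ⊥-elim ∘ triple-apart-apex r r′ (λ ())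
  triple-injective wrap     wrap     _ = refl
  triple-injective pendantᵃ pendantᵃ _ = refl
  triple-injective pendantᵇ pendantᵇ _ = refl
  triple-injective closing  closing  _ = refl

  zero∉ladder-pair : ∀ {k} (k<q : k < q) → node 0 ∉ₗ pair (ladder k k<q)
  zero∉ladder-pair k<q = All¬⇒¬Any (node≢ z≤n (s≤s (<⇒≤ k<q)) (λ ()) ∷ (λ ()) ∷ [])

  pendant∉pair-pendantᵇ : node m ∉ₗ pair pendantᵇ
  pendant∉pair-pendantᵇ = All¬⇒¬Any (node≢ ≤-refl z≤n (λ ()) ∷ (λ ()) ∷ [])

  pendant∉pair-closing : node m ∉ₗ pair closing
  pendant∉pair-closing = All¬⇒¬Any (node≢ ≤-refl z≤n (λ ()) ∷ node≢ ≤-refl (s≤s z≤n) (>⇒≢ (s≤s 0<q)) ∷ [])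

  pair-injective : ∀ r r′ → ⟦ pair r ⟧ ≡ ⟦ pair r′ ⟧ → index r ≡ index r′
  pair-injective r@(ladder k k<q) r′@(ladder k′ k′<q) eq with ⟦⟧-≡⇒⊆ (pair r) (pair r′) eq (here refl)
  ... | here 1+k≈1+k′ = suc-injective (node-injective (s≤s (<⇒≤ k<q)) (s≤s (<⇒≤ k′<q)) 1+k≈1+k′)
  ... | there (here ())
  pair-injective r@(ladder _ k<q) r′@wrap     = ⊥-elim ∘ ⟦⟧-apart′ (pair r) (pair r′) (here refl) (zero∉ladder-pair k<q)
  pair-injective r@(ladder _ k<q) r′@pendantᵃ = ⊥-elim ∘ ⟦⟧-apart′ (pair r) (pair r′) (here refl) (zero∉ladder-pair k<q)
  pair-injective r@(ladder _ k<q) r′@pendantᵇ = ⊥-elim ∘ ⟦⟧-apart′ (pair r) (pair r′) (here refl) (zero∉ladder-pair k<q)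
  pair-injective r@(ladder _ k<q) r′@closing  = ⊥-elim ∘ ⟦⟧-apart′ (pair r) (pair r′) (here refl) (zero∉ladder-pair k<q)
  pair-injective r@wrap     r′@(ladder _ k<q) = ⊥-elim ∘ ⟦⟧-apart (pair r) (pair r′) (here refl) (zero∉ladder-pair k<q)
  pair-injective r@pendantᵃ r′@(ladder _ k<q) = ⊥-elim ∘ ⟦⟧-apart (pair r) (pair r′) (here refl) (zero∉ladder-pair k<q)
  pair-injective r@pendantᵇ r′@(ladder _ k<q) = ⊥-elim ∘ ⟦⟧-apart (pair r) (pair r′) (here refl) (zero∉ladder-pair k<q)
  pair-injective r@closing  r′@(ladder _ k<q) = ⊥-elim ∘ ⟦⟧-apart (pair r) (pair r′) (here refl) (zero∉ladder-pair k<q)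
  pair-injective r@wrap     r′@pendantᵃ = ⊥-elim ∘ ⟦⟧-apart  (pair r) (pair r′) (there (here refl)) (All¬⇒¬Any ((λ ()) ∷ (λ ()) ∷ []))
  pair-injective r@wrap     r′@pendantᵇ = ⊥-elim ∘ ⟦⟧-apart  (pair r) (pair r′) (there (here refl)) (All¬⇒¬Any ((λ ()) ∷ (λ ()) ∷ []))
  pair-injective r@wrap     r′@closing  = ⊥-elim ∘ ⟦⟧-apart  (pair r) (pair r′) (there (here refl)) (All¬⇒¬Any ((λ ()) ∷ (λ ()) ∷ []))
  pair-injective r@pendantᵃ r′@wrap     = ⊥-elim ∘ ⟦⟧-apart′ (pair r) (pair r′) (there (here refl)) (All¬⇒¬Any ((λ ()) ∷ (λ ()) ∷ []))
  pair-injective r@pendantᵇ r′@wrap     = ⊥-elim ∘ ⟦⟧-apart′ (pair r) (pair r′) (there (here refl)) (All¬⇒¬Any ((λ ()) ∷ (λ ()) ∷ []))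
  pair-injective r@closing  r′@wrap     = ⊥-elim ∘ ⟦⟧-apart′ (pair r) (pair r′) (there (here refl)) (All¬⇒¬Any ((λ ()) ∷ (λ ()) ∷ []))
  pair-injective r@pendantᵇ r′@closing  = ⊥-elim ∘ ⟦⟧-apart  (pair r) (pair r′) (there (here refl)) (All¬⇒¬Any ((λ ()) ∷ (λ ()) ∷ []))
  pair-injective r@closing  r′@pendantᵇ = ⊥-elim ∘ ⟦⟧-apart′ (pair r) (pair r′) (there (here refl)) (All¬⇒¬Any ((λ ()) ∷ (λ ()) ∷ []))
  pair-injective r@pendantᵃ r′@pendantᵇ = ⊥-elim ∘ ⟦⟧-apart  (pair r) (pair r′) (there (here refl)) pendant∉pair-pendantᵇ
  pair-injective r@pendantᵇ r′@pendantᵃ = ⊥-elim ∘ ⟦⟧-apart′ (pair r) (pair r′) (there (here refl)) pendant∉pair-pendantᵇ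
  pair-injective r@pendantᵃ r′@closing  = ⊥-elim ∘ ⟦⟧-apart  (pair r) (pair r′) (there (here refl)) pendant∉pair-closing
  pair-injective r@closing  r′@pendantᵃ = ⊥-elim ∘ ⟦⟧-apart′ (pair r) (pair r′) (there (here refl)) pendant∉pair-closing
  pair-injective wrap     wrap     _ = refl
  pair-injective pendantᵃ pendantᵃ _ = refl
  pair-injective pendantᵇ pendantᵇ _ = refl
  pair-injective closing  closing  _ = refl

  f-injective : ∀ i j → i < N → j < N → f i ≡ f j → i ≡ j
  f-injective i j i<N j<N fi≡fj with position i i<N | position j j<N
  ... | at-triple r | at-triple r′ =
    cong (λ k → k + k) (triple-injective r r′ (trans (sym (f-triple r)) (trans fi≡fj (f-triple r′))))
  ... | at-pair r | at-pair r′ =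
    cong (λ k → suc (k + k)) (pair-injective r r′ (trans (sym (f-pair r)) (trans fi≡fj (f-pair r′))))
  ... | at-triple r | at-pair r′ =
    contradiction (trans (sym (∣f-triple∣ r)) (trans (cong ∣_∣ fi≡fj) (∣f-pair∣ r′))) λ ()
  ... | at-pair r | at-triple r′ =
    contradiction (trans (sym (∣f-pair∣ r)) (trans (cong ∣_∣ fi≡fj) (∣f-triple∣ r′))) λ ()

  f-layers : ∀ i → i < N → ∣ f i ∣ ≡ 2 ⊎ ∣ f i ∣ ≡ 3
  f-layers i i<N with position i i<N
  ... | at-triple r = inj₂ (∣f-triple∣ r)
  ... | at-pair r   = inj₁ (∣f-pair∣ r)

  f-adjacent : ∀ i → suc i < N → QAdj (f i) (f (suc i))
  f-adjacent i 1+i<N with position i (<-trans (n<1+n i) 1+i<N)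
  ... | at-triple r = subst₂ QAdj (sym (f-triple r)) (sym (f-pair r))
    (QAdj-sym (QAdj-⟦⟧ (pair-unique r) (triple-unique r) (pair⊆triple r) (cong suc (sym (length-pair r)))))
  ... | at-pair r = subst₂ QAdj (sym (f-pair r)) (sym (f-next-triple r))
    (QAdj-⟦⟧ (pair-unique r) (triple-unique _) (pair⊆next-triple r r<3+q) (cong suc (sym (length-pair r))))
    where
    r<3+q : index r < 3 + q
    r<3+q = s<s⁻¹ (double-<⇒< (subst (suc (index r) + suc (index r) <_) N≡double
              (subst (_< N) (cong suc (sym (+-suc (index r) (index r)))) 1+i<N)))

  N∸1≡closing : N ∸ 1 ≡ suc (index closing + index closing)
  N∸1≡closing = cong (_∸ 1) (trans N≡double (cong suc (+-suc (3 + q) (3 + q))))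

  f-closing : QAdj (f (N ∸ 1)) (f 0)
  f-closing = subst₂ QAdj (sym (trans (cong f N∸1≡closing) (f-pair closing))) (sym (f-triple first))
    (QAdj-⟦⟧ (pair-unique closing) (triple-unique first) (doubleton-⊆ (here refl) (there (here refl))) refl)
    where first = ladder 0 0<q

  cycle-embedding : IsCycleEmbedding23 N n f
  cycle-embedding = f-injective , f-layers , f-adjacent , f-closing

  edge-is-triple : ∀ {e} → IsEdgeℋ N n f e → ∃[ r ] e ≡ ⟦ triple r ⟧
  edge-is-triple (i , i<N , ∣fi∣≡3 , refl) with position i i<N
  ... | at-triple r = r , f-triple r
  ... | at-pair r   = contradiction (trans (sym ∣fi∣≡3) (∣f-pair∣ r)) λ ()

  triple-rainbow : Odd q → ∀ r → Unique (map (liftColour m) (triple r))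
  triple-rainbow q-odd r = triangle-rainbow {s = apex r} {u = vertex (end₁ r)} {v = vertex (end₂ r)}
    (GAdj-side≢ (Odd⇒parity≡1ℙ q-odd) (rung-GAdj r))

  three-partite : Odd q → Is3Partite N n f
  three-partite q-odd = liftColour m ∘ point , rainbow
    where
    rainbow : ∀ e → IsEdgeℋ N n f e → ∀ x y → x ∈ e → y ∈ e → x ≢ y →
              liftColour m (point x) ≢ liftColour m (point y)
    rainbow e e-edge x y x∈e y∈e x≢y with edge-is-triple e-edge
    ... | r , refl = rainbow-⟦⟧ (liftColour m) (triple r) (triple-rainbow q-odd r) x∈e y∈e x≢y

  subgraph-of-two-lift : SubgraphOfTwoLift N n f m
  subgraph-of-two-lift = point , (λ _ _ _ _ → to-injective) , lifts
    where
    lifts : ∀ e → IsEdgeℋ N n f e → ∀ x y z → x ∈ e → y ∈ e → z ∈ e →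
            x ≢ y → y ≢ z → x ≢ z → LiftEdge m (point x) (point y) (point z)
    lifts e e-edge x y z x∈e y∈e z∈e x≢y y≢z x≢z with edge-is-triple e-edge
    ... | r , refl =
      triangle-LiftEdge (rung-GAdj r) (∈⟦⟧⁻ {triple r} x∈e) (∈⟦⟧⁻ {triple r} y∈e) (∈⟦⟧⁻ {triple r} z∈e)
        (x≢y ∘ to-injective) (y≢z ∘ to-injective) (x≢z ∘ to-injective)

lemma3 : ∀ (ℓ : ℕ) → Odd ℓ → 7 ≤ ℓ →
    Σ ℕ λ n → Σ (ℕ → Subset n) λ f →
      Is3PartiteRep (2 * ℓ) n f × SubgraphOfTwoLift (2 * ℓ) n f (ℓ ∸ 3)
lemma3 _ (0 , refl) (s≤s ())
lemma3 _ (1 , refl) (s≤s (s≤s (s≤s ())))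
lemma3 _ (2 , refl) (s≤s (s≤s (s≤s (s≤s (s≤s ())))))
lemma3 _ (suc (suc (suc t)) , refl) _ =
  n , f , (cycle-embedding , three-partite q-odd) , subgraph-of-two-lift
  where
  -- For ℓ = 2 (t + 3) + 1 this is the q with 4 + q and ℓ definitionally equal.
  q : ℕ
  q = t + (3 + (t + 0))
  q-odd : Odd q
  q-odd = suc t , trans (+-suc t _) (cong suc (+-suc t _))
  open Construction q (≤-trans (s≤s (s≤s z≤n)) (m≤n+m _ t))
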